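{- Let $n\geq 2$ be an integer and let $LG_n = P_2 \,\square\, P_n$ be the Ladder graph on $2n$ vertices. Then $$\gamma_{SR}(LG_n) = \left\lfloor \frac{n+2}{2} \right\rfloor + 1.$$
   Context: All graphs are finite, simple and undirected. For a vertex $u$ of a graph $G$, $N_G[u]$ denotes the closed neighbourhood of $u$ (the vertex $u$ together with all vertices adjacent to $u$). A signed Roman dominating function (SRDF) on $G$ is a function $f: V(G)\to\{ -1,1,2\}$ such that (i) $\sum_{v\in N_G[u]} f(v)\geq 1$ for every $u\in V(G)$, and (ii) every vertex $u$ with $f(u)=-1$ is adjacent to at least one vertex $v$ with $f(v)=2$. The weight of $f$ is $w(f)=\sum_{u\in V(G)} f(u)$, and the signed Roman domination number $\gamma_{SR}(G)$ is the minimum weight of an SRDF on $G$. $P_n$ denotes the path on $n$ vertices and $\square$ the Cartesian product of graphs. Concretely, $LG_n$ has vertex set $\{(1,i),(2,i): 1\le i\le n\}$ and edges $\{(1,i),(2,i)\}$ for $1\le i\le n$, and $\{(1,i),(1,i+1)\}$, $\{(2,i),(2,i+1)\}$ for $1\le i\le n-1$. -}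

module Defs where

open import Data.Nat as ℕ using (ℕ; suc)
open import Data.Integer as ℤ using (ℤ; +_; -[1+_]; _≤_)
open import Data.Fin as Fin using (Fin; toℕ)
open import Data.Bool using (Bool; true; false; _∧_; _∨_; not; if_then_else_)
open import Data.List using (List; map; foldr; allFin; cartesianProduct)
open import Data.Product using (_×_; _,_; Σ)
open import Relation.Nullary.Decidable using (⌊_⌋)
open import Relation.Binary.PropositionalEquality using (_≡_)

-- Finite simple graphs: vertex set enumerated by a duplicate-free list
-- (here always a full enumeration of a finite type), Boolean adjacency.

record Graph : Set₁ where
  field
    V     : Set
    verts : List V
    _≟V_  : V → V → Bool
    adj   : V → V → Bool
open Graph public

data Label : Set where
  minus1 one two : Label

val : Label → ℤ
val minus1 = -[1+ 0 ]
val one    = + 1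
val two    = + 2

sumℤ : List ℤ → ℤ
sumℤ = foldr ℤ._+_ (+ 0)

inClosedNbhd : (G : Graph) → V G → V G → Bool
inClosedNbhd G u v = _≟V_ G u v ∨ adj G u v

nbhdSum : (G : Graph) → (V G → Label) → V G → ℤ
nbhdSum G f u =
  sumℤ (map (λ v → if inClosedNbhd G u v then val (f v) else + 0) (verts G))

weight : (G : Graph) → (V G → Label) → ℤ
weight G f = sumℤ (map (λ v → val (f v)) (verts G))

record IsSRDF (G : Graph) (f : V G → Label) : Set where
  field
    closedSum    : ∀ u → + 1 ≤ nbhdSum G f u
    minusCovered : ∀ u → f u ≡ minus1 →
                   Σ (V G) (λ v → (adj G u v ≡ true) × (f v ≡ two))

γSR≡ : Graph → ℤ → Set
γSR≡ G k =
  Σ (V G → Label) (λ f → IsSRDF G f × (weight G f ≡ k))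
  × (∀ f → IsSRDF G f → k ≤ weight G f)

-- Ladder graph LG_n = P_2 □ P_n.  Vertex (r , i) ∈ Fin 2 × Fin n stands for
-- the paper's (r+1 , i+1).  Edges: {(r,i),(s,i)} for r ≠ s, and
-- {(r,i),(r,j)} for |i - j| = 1.

eqℕ : ℕ → ℕ → Bool
eqℕ m k = ⌊ m ℕ.≟ k ⌋

ladderAdj : ∀ {n} → Fin 2 × Fin n → Fin 2 × Fin n → Bool
ladderAdj (r , i) (s , j) =
  (eqℕ (toℕ i) (toℕ j) ∧ not (eqℕ (toℕ r) (toℕ s)))
  ∨ (eqℕ (toℕ r) (toℕ s) ∧ (eqℕ (suc (toℕ i)) (toℕ j) ∨ eqℕ (suc (toℕ j)) (toℕ i)))

ladderEq : ∀ {n} → Fin 2 × Fin n → Fin 2 × Fin n → Bool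
ladderEq (r , i) (s , j) = eqℕ (toℕ r) (toℕ s) ∧ eqℕ (toℕ i) (toℕ j)

LG : ℕ → Graph
LG n = record
  { V     = Fin 2 × Fin n
  ; verts = cartesianProduct (allFin 2) (allFin n)
  ; _≟V_  = ladderEq
  ; adj   = ladderAdj
  }

-- Read the ladder column by column. Both SRDF conditions at a vertex involve only its own column and
-- the two neighbouring ones, so an SRDF on LG n is a sequence of n columns each of which is admissible
-- between its neighbours. Give a column with label sum s the cost 2s - 1; the columns of f then cost
-- 2 w(f) - n in total. A potential on pairs of consecutive columns, checked on all 9^3 triples, shows
-- that every admissible sequence of at least two columns costs at least 3, while the column (-1,1)
-- followed by a period-4 pattern costs at most 4. So every SRDF f has n + 3 ≤ 2 w(f), the pattern has
-- 2 w(f) ≤ n + 4, and the least integer w with n + 3 ≤ 2w is ⌊(n + 2)/2⌋ + 1.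

module Submission where

open import Defs
open import Data.Nat using (ℕ; _≤_; _/_; _+_)
open import Data.Integer using (+_)

open import Data.Bool using (Bool; true; false; _∨_; if_then_else_; T)
open import Data.Bool.Properties using (∨-identityʳ; ∨-zeroʳ; ∧-zeroʳ; ∧-identityʳ)
open import Data.Fin using (Fin; toℕ) renaming (suc to sucF)
open import Data.Fin.Patterns using (0F; 1F)
open import Data.Fin.Properties using (toℕ-injective; all?)
open import Data.Integer as ℤ using (ℤ; -[1+_])
import Data.Integer.Properties as ℤ
open import Data.Integer.Tactic.RingSolver using (solve-∀)
open import Data.List using (List; []; _∷_; _++_; map; tabulate; allFin)
open import Data.List.Properties using (map-++; map-∘; ++-identityʳ)
open import Data.Maybe using (Maybe; just; nothing; maybe′)
open import Data.Maybe.Relation.Unary.Any as Any using (Any; just)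
open import Data.Nat as ℕ using (zero; suc; _%_)
open import Data.Nat.DivMod using (m≡m%n+[m/n]*n; m%n<n)
import Data.Nat.Properties as ℕ
open import Data.Product using (_×_; _,_; Σ; proj₁; proj₂)
open import Data.Sum using (_⊎_; inj₁; inj₂)
open import Data.Vec.Functional using (Vector; head; tail) renaming (_∷_ to _∷ᵥ_)
open import Function using (_∘_)
open import Relation.Binary.PropositionalEquality
open import Relation.Nullary.Negation using (¬_; contradiction)
open import Relation.Binary.Definitions using (DecidableEquality)
open import Relation.Nullary.Decidable
  using (Dec; yes; no; map′; _×-dec_; _⊎-dec_; _→-dec_; isYes≗does; toWitness)

open import Algebra.Properties.CommutativeMonoid.Sum ℤ.+-0-commutativeMonoid
  using (sum; sum-cong-≗; sum-replicate-zero; ∑-distrib-+)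

open ≡-Reasoning

eqℕ-suc : ∀ m k → eqℕ (suc m) (suc k) ≡ eqℕ m k
eqℕ-suc m k = trans (isYes≗does (suc m ℕ.≟ suc k)) (sym (isYes≗does (m ℕ.≟ k)))

eqℕ-refl : ∀ m → eqℕ m m ≡ true
eqℕ-refl zero    = refl
eqℕ-refl (suc m) = trans (eqℕ-suc m m) (eqℕ-refl m)

eqℕ⇒≡ : ∀ {m k} → eqℕ m k ≡ true → m ≡ k
eqℕ⇒≡ {m} {k} e = toWitness {a? = m ℕ.≟ k} (subst T (sym e) _)

∨⇒⊎ : ∀ {x y} → x ∨ y ≡ true → x ≡ true ⊎ y ≡ true
∨⇒⊎ {true}  _ = inj₁ refl
∨⇒⊎ {false} e = inj₂ e

_‼_ : ∀ {n} {A : Set} → Vector A n → ℕ → Maybe A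
_‼_ {zero}  F k       = nothing
_‼_ {suc n} F zero    = just (head F)
_‼_ {suc n} F (suc k) = tail F ‼ k

preceding : ∀ {n} {A : Set} → Maybe A → Vector A n → ℕ → Maybe A
preceding p F zero    = p
preceding p F (suc k) = F ‼ k

‼-toℕ : ∀ {n} {A : Set} (F : Vector A n) i → F ‼ toℕ i ≡ just (F i)
‼-toℕ F 0F       = refl
‼-toℕ F (sucF i) = ‼-toℕ (tail F) i

preceding-tail : ∀ {n} {A : Set} p (F : Vector A (suc n)) k →
                 preceding p F (suc k) ≡ preceding (just (head F)) (tail F) k
preceding-tail p F zero    = refl
preceding-tail p F (suc k) = refl

module _ {A : Set} {P : A → Set} where

  ‼-Any : ∀ {n} (F : Vector A n) k → Any P (F ‼ k) → Σ (Fin n) λ j → toℕ j ≡ k × P (F j)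
  ‼-Any {suc n} F zero    (just p) = 0F , refl , p
  ‼-Any {suc n} F (suc k) a with ‼-Any (tail F) k a
  ... | j , e , p = sucF j , cong suc e , p

  preceding-Any : ∀ {n} (F : Vector A n) k → Any P (preceding nothing F k) →
                  Σ (Fin n) λ j → suc (toℕ j) ≡ k × P (F j)
  preceding-Any F (suc k) a with ‼-Any F k a
  ... | j , e , p = j , cong suc e , p

  Any-‼ : ∀ {n} (F : Vector A n) {j k} → toℕ j ≡ k → P (F j) → Any P (F ‼ k)
  Any-‼ F {j} refl p = subst (Any P) (sym (‼-toℕ F j)) (just p)

  Any-preceding : ∀ {n} (F : Vector A n) {j k} → suc (toℕ j) ≡ k → P (F j) → Any P (preceding nothing F k)
  Any-preceding F refl p = Any-‼ F refl p

sumℤ-++ : ∀ xs ys → sumℤ (xs ++ ys) ≡ sumℤ xs ℤ.+ sumℤ ys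
sumℤ-++ []       ys = sym (ℤ.+-identityˡ _)
sumℤ-++ (x ∷ xs) ys = trans (cong (λ s → x ℤ.+ s) (sumℤ-++ xs ys)) (sym (ℤ.+-assoc x _ _))

sumℤ-map-tabulate : ∀ {n} {A : Set} (h : A → ℤ) (φ : Fin n → A) →
                    sumℤ (map h (tabulate φ)) ≡ sum (h ∘ φ)
sumℤ-map-tabulate {zero}  h φ = refl
sumℤ-map-tabulate {suc n} h φ = cong (λ s → h (φ 0F) ℤ.+ s) (sumℤ-map-tabulate h (φ ∘ sucF))

∑-if-zero : ∀ {n} (b : Fin n → Bool) (h : Fin n → ℤ) →
            (∀ j → b j ≡ false) → sum (λ j → if b j then h j else + 0) ≡ + 0
∑-if-zero {n} b h never = trans (sum-cong-≗ (λ j → cong (λ c → if c then h j else + 0) (never j)))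
                                (sum-replicate-zero n)

∑-point : ∀ {n} {A : Set} (h : A → ℤ) (F : Vector A n) k →
          sum (λ j → if eqℕ k (toℕ j) then h (F j) else + 0) ≡ maybe′ h (+ 0) (F ‼ k)
∑-point {zero}  h F k       = refl
∑-point {suc n} h F zero    =
  trans (cong (λ s → h (head F) ℤ.+ s) (∑-if-zero {n} _ (h ∘ tail F) (λ _ → refl))) (ℤ.+-identityʳ _)
∑-point {suc n} h F (suc k) = begin
  + 0 ℤ.+ sum (λ j → if eqℕ (suc k) (suc (toℕ j)) then h (tail F j) else + 0)
    ≡⟨ ℤ.+-identityˡ _ ⟩
  sum (λ j → if eqℕ (suc k) (suc (toℕ j)) then h (tail F j) else + 0)
    ≡⟨ sum-cong-≗ (λ j → cong (λ c → if c then h (tail F j) else + 0) (eqℕ-suc k (toℕ j))) ⟩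
  sum (λ j → if eqℕ k (toℕ j) then h (tail F j) else + 0)
    ≡⟨ ∑-point h (tail F) k ⟩
  maybe′ h (+ 0) (tail F ‼ k) ∎

near : ℕ → ℕ → Bool
near k m = eqℕ k m ∨ (eqℕ (suc k) m ∨ eqℕ (suc m) k)

near-suc : ∀ k m → near (suc k) (suc m) ≡ near k m
near-suc k m rewrite eqℕ-suc k m | eqℕ-suc (suc k) m | eqℕ-suc (suc m) k = refl

∑-near : ∀ {n} {A : Set} (h : A → ℤ) (F : Vector A n) k →
         sum (λ j → if near k (toℕ j) then h (F j) else + 0)
         ≡ maybe′ h (+ 0) (F ‼ k) ℤ.+ maybe′ h (+ 0) (F ‼ suc k)
           ℤ.+ maybe′ h (+ 0) (preceding nothing F k)
∑-near {zero}  h F zero    = refl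
∑-near {zero}  h F (suc k) = refl
∑-near {suc n} h F zero    = begin
  h (head F) ℤ.+ sum (λ j → if near 0 (suc (toℕ j)) then h (tail F j) else + 0)
    ≡⟨ cong (λ s → h (head F) ℤ.+ s) (trans (sum-cong-≗ near-0-suc) (∑-point h (tail F) 0)) ⟩
  h (head F) ℤ.+ maybe′ h (+ 0) (tail F ‼ 0)
    ≡⟨ ℤ.+-identityʳ _ ⟨
  h (head F) ℤ.+ maybe′ h (+ 0) (tail F ‼ 0) ℤ.+ + 0 ∎
  where
  near-0-suc : ∀ j → (if near 0 (suc (toℕ j)) then h (tail F j) else + 0)
                     ≡ (if eqℕ 0 (toℕ j) then h (tail F j) else + 0)
  near-0-suc j = cong (λ c → if c then h (tail F j) else + 0)
                      (trans (∨-identityʳ _) (eqℕ-suc 0 (toℕ j)))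
∑-near {suc n} h F (suc zero) = begin
  h (head F) ℤ.+ sum (λ j → if near 1 (suc (toℕ j)) then h (tail F j) else + 0)
    ≡⟨ cong (λ s → h (head F) ℤ.+ s) (trans (sum-cong-≗ near-1-suc) (∑-near h (tail F) 0)) ⟩
  h (head F) ℤ.+ (maybe′ h (+ 0) (tail F ‼ 0) ℤ.+ maybe′ h (+ 0) (tail F ‼ 1) ℤ.+ + 0)
    ≡⟨ rotate (h (head F)) (maybe′ h (+ 0) (tail F ‼ 0)) (maybe′ h (+ 0) (tail F ‼ 1)) ⟩
  maybe′ h (+ 0) (tail F ‼ 0) ℤ.+ maybe′ h (+ 0) (tail F ‼ 1) ℤ.+ h (head F) ∎
  where
  near-1-suc : ∀ j → (if near 1 (suc (toℕ j)) then h (tail F j) else + 0)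
                     ≡ (if near 0 (toℕ j) then h (tail F j) else + 0)
  near-1-suc j = cong (λ c → if c then h (tail F j) else + 0) (near-suc 0 (toℕ j))
  rotate : ∀ a x y → a ℤ.+ (x ℤ.+ y ℤ.+ + 0) ≡ x ℤ.+ y ℤ.+ a
  rotate = solve-∀
∑-near {suc n} h F (suc (suc k)) = begin
  + 0 ℤ.+ sum (λ j → if near (suc (suc k)) (suc (toℕ j)) then h (tail F j) else + 0)
    ≡⟨ ℤ.+-identityˡ _ ⟩
  sum (λ j → if near (suc (suc k)) (suc (toℕ j)) then h (tail F j) else + 0)
    ≡⟨ sum-cong-≗ (λ j → cong (λ c → if c then h (tail F j) else + 0) (near-suc (suc k) (toℕ j))) ⟩
  sum (λ j → if near (suc k) (toℕ j) then h (tail F j) else + 0)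
    ≡⟨ ∑-near h (tail F) (suc k) ⟩
  _ ∎

∑-double-pred : ∀ {n} (g : Vector ℤ n) → sum (λ j → g j ℤ.+ g j ℤ.- + 1) ≡ sum g ℤ.+ sum g ℤ.- + n
∑-double-pred {zero}  g = refl
∑-double-pred {suc n} g = begin
  g 0F ℤ.+ g 0F ℤ.- + 1 ℤ.+ sum (λ j → g (sucF j) ℤ.+ g (sucF j) ℤ.- + 1)
    ≡⟨ cong (λ s → g 0F ℤ.+ g 0F ℤ.- + 1 ℤ.+ s) (∑-double-pred (tail g)) ⟩
  g 0F ℤ.+ g 0F ℤ.- + 1 ℤ.+ (sum (tail g) ℤ.+ sum (tail g) ℤ.- + n)
    ≡⟨ regroup (g 0F) (sum (tail g)) (+ n) ⟩
  sum g ℤ.+ sum g ℤ.- (+ 1 ℤ.+ + n) ∎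
  where
  regroup : ∀ a s m → a ℤ.+ a ℤ.- + 1 ℤ.+ (s ℤ.+ s ℤ.- m) ≡ (a ℤ.+ s) ℤ.+ (a ℤ.+ s) ℤ.- (+ 1 ℤ.+ m)
  regroup = solve-∀

sumℤ-ladder : ∀ {n} (h : Fin 2 × Fin n → ℤ) →
              sumℤ (map h (verts (LG n))) ≡ sum (λ j → h (0F , j)) ℤ.+ sum (λ j → h (1F , j))
sumℤ-ladder {n} h = begin
  sumℤ (map h (rowVertices 0F ++ (rowVertices 1F ++ [])))
    ≡⟨ cong sumℤ (map-++ h (rowVertices 0F) _) ⟩
  sumℤ (map h (rowVertices 0F) ++ map h (rowVertices 1F ++ []))
    ≡⟨ sumℤ-++ (map h (rowVertices 0F)) _ ⟩
  sumℤ (map h (rowVertices 0F)) ℤ.+ sumℤ (map h (rowVertices 1F ++ []))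
    ≡⟨ cong (λ xs → sumℤ (map h (rowVertices 0F)) ℤ.+ sumℤ (map h xs)) (++-identityʳ (rowVertices 1F)) ⟩
  sumℤ (map h (rowVertices 0F)) ℤ.+ sumℤ (map h (rowVertices 1F))
    ≡⟨ cong₂ ℤ._+_ (sum-rowVertices 0F) (sum-rowVertices 1F) ⟩
  sum (λ j → h (0F , j)) ℤ.+ sum (λ j → h (1F , j)) ∎
  where
  rowVertices : Fin 2 → List (Fin 2 × Fin n)
  rowVertices r = map (r ,_) (allFin n)
  sum-rowVertices : ∀ r → sumℤ (map h (rowVertices r)) ≡ sum (λ j → h (r , j))
  sum-rowVertices r = trans (cong sumℤ (sym (map-∘ (allFin n)))) (sumℤ-map-tabulate (h ∘ (r ,_)) (λ j → j))

opposite : Fin 2 → Fin 2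
opposite 0F = 1F
opposite 1F = 0F

data LadderAdjacent {n : ℕ} : Fin 2 × Fin n → Fin 2 × Fin n → Set where
  rung  : ∀ {r i} → LadderAdjacent (r , i) (opposite r , i)
  along : ∀ {r i j} → toℕ j ≡ suc (toℕ i) ⊎ suc (toℕ j) ≡ toℕ i → LadderAdjacent (r , i) (r , j)

module _ {n : ℕ} where

  ladderAdj-row : ∀ r (i j : Fin n) →
    ladderAdj (r , i) (r , j) ≡ eqℕ (suc (toℕ i)) (toℕ j) ∨ eqℕ (suc (toℕ j)) (toℕ i)
  ladderAdj-row 0F i j rewrite ∧-zeroʳ (eqℕ (toℕ i) (toℕ j)) = refl
  ladderAdj-row 1F i j rewrite ∧-zeroʳ (eqℕ (toℕ i) (toℕ j)) = refl

  ladderAdj-rung : ∀ r (i j : Fin n) → ladderAdj (r , i) (opposite r , j) ≡ eqℕ (toℕ i) (toℕ j)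
  ladderAdj-rung 0F i j = trans (∨-identityʳ _) (∧-identityʳ _)
  ladderAdj-rung 1F i j = trans (∨-identityʳ _) (∧-identityʳ _)

  closedNbhd-row : ∀ r (i j : Fin n) → inClosedNbhd (LG n) (r , i) (r , j) ≡ near (toℕ i) (toℕ j)
  closedNbhd-row 0F i j = cong (eqℕ (toℕ i) (toℕ j) ∨_) (ladderAdj-row 0F i j)
  closedNbhd-row 1F i j = cong (eqℕ (toℕ i) (toℕ j) ∨_) (ladderAdj-row 1F i j)

  closedNbhd-rung : ∀ r (i j : Fin n) → inClosedNbhd (LG n) (r , i) (opposite r , j) ≡ eqℕ (toℕ i) (toℕ j)
  closedNbhd-rung 0F = ladderAdj-rung 0F
  closedNbhd-rung 1F = ladderAdj-rung 1F

  sumℤ-ladder-rows : ∀ r (h : Fin 2 × Fin n → ℤ) →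
    sumℤ (map h (verts (LG n))) ≡ sum (λ j → h (r , j)) ℤ.+ sum (λ j → h (opposite r , j))
  sumℤ-ladder-rows 0F h = sumℤ-ladder h
  sumℤ-ladder-rows 1F h = trans (sumℤ-ladder h) (ℤ.+-comm (sum (λ j → h (0F , j))) _)

  ladderAdj-sound : ∀ {u v : Fin 2 × Fin n} → LadderAdjacent u v → ladderAdj u v ≡ true
  ladderAdj-sound (rung {r} {i}) = trans (ladderAdj-rung r i i) (eqℕ-refl (toℕ i))
  ladderAdj-sound (along {r} {i} {j} (inj₁ e))
    rewrite ladderAdj-row r i j | e | eqℕ-refl (suc (toℕ i)) = refl
  ladderAdj-sound (along {r} {i} {j} (inj₂ e))
    rewrite ladderAdj-row r i j | sym e | eqℕ-refl (suc (toℕ j)) = ∨-zeroʳ _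

  private
    rung-of : ∀ {r} {i j : Fin n} → eqℕ (toℕ i) (toℕ j) ≡ true → LadderAdjacent (r , i) (opposite r , j)
    rung-of e with toℕ-injective (eqℕ⇒≡ e)
    ... | refl = rung

    along-of : ∀ {r} {i j : Fin n} → eqℕ (suc (toℕ i)) (toℕ j) ∨ eqℕ (suc (toℕ j)) (toℕ i) ≡ true →
               LadderAdjacent (r , i) (r , j)
    along-of e with ∨⇒⊎ e
    ... | inj₁ e′ = along (inj₁ (sym (eqℕ⇒≡ e′)))
    ... | inj₂ e′ = along (inj₂ (eqℕ⇒≡ e′))

  ladderAdj-complete : ∀ {u v : Fin 2 × Fin n} → ladderAdj u v ≡ true → LadderAdjacent u v
  ladderAdj-complete {0F , i} {0F , j} e = along-of (trans (sym (ladderAdj-row 0F i j)) e)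
  ladderAdj-complete {0F , i} {1F , j} e = rung-of (trans (sym (ladderAdj-rung 0F i j)) e)
  ladderAdj-complete {1F , i} {0F , j} e = rung-of (trans (sym (ladderAdj-rung 1F i j)) e)
  ladderAdj-complete {1F , i} {1F , j} e = along-of (trans (sym (ladderAdj-row 1F i j)) e)

Column : Set
Column = Label × Label

row : Fin 2 → Column → Label
row 0F = proj₁
row 1F = proj₂

columns : ∀ {n} → (Fin 2 × Fin n → Label) → Vector Column n
columns f j = f (0F , j) , f (1F , j)

-- columns (labelling F) is F up to η, so the two are interchangeable in types below.
labelling : ∀ {n} → Vector Column n → Fin 2 × Fin n → Label
labelling F (r , j) = row r (F j)

row-columns : ∀ {n} (f : Fin 2 × Fin n → Label) r j → row r (columns f j) ≡ f (r , j)
row-columns f 0F j = refl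
row-columns f 1F j = refl

valueAt : Fin 2 → Maybe Column → ℤ
valueAt r = maybe′ (val ∘ row r) (+ 0)

TwoAt : Fin 2 → Maybe Column → Set
TwoAt r = Any (λ c → row r c ≡ two)

localNbhdSum : Fin 2 → Maybe Column → Column → Maybe Column → ℤ
localNbhdSum r a b c = val (row r b) ℤ.+ valueAt r c ℤ.+ valueAt r a ℤ.+ val (row (opposite r) b)

Covered : Fin 2 → Maybe Column → Column → Maybe Column → Set
Covered r a b c = row (opposite r) b ≡ two ⊎ TwoAt r a ⊎ TwoAt r c

-- The SRDF conditions at the two vertices of column b, whose neighbouring columns are a and c
-- (nothing beyond an end of the ladder).
Admissible : Maybe Column → Column → Maybe Column → Set
Admissible a b c = ∀ r → + 1 ℤ.≤ localNbhdSum r a b c × (row r b ≡ minus1 → Covered r a b c)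

LocallyAdmissible : ∀ {n} → Maybe Column → Vector Column n → Set
LocallyAdmissible p F = ∀ i → Admissible (preceding p F (toℕ i)) (F i) (F ‼ suc (toℕ i))

locallyAdmissible-tail : ∀ {n} p (F : Vector Column (suc n)) →
  LocallyAdmissible p F → LocallyAdmissible (just (head F)) (tail F)
locallyAdmissible-tail p F adm i =
  subst (λ a → Admissible a (tail F i) (tail F ‼ suc (toℕ i))) (preceding-tail p F (toℕ i)) (adm (sucF i))

locallyAdmissible-cons : ∀ {n} p (F : Vector Column (suc n)) →
  Admissible p (head F) (tail F ‼ 0) → LocallyAdmissible (just (head F)) (tail F) → LocallyAdmissible p F
locallyAdmissible-cons p F adm₀ adm 0F       = adm₀
locallyAdmissible-cons p F adm₀ adm (sucF i) =
  subst (λ a → Admissible a (tail F i) (tail F ‼ suc (toℕ i))) (sym (preceding-tail p F (toℕ i))) (adm i)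

nbhdSum-ladder : ∀ {n} (f : Fin 2 × Fin n → Label) r i →
  nbhdSum (LG n) f (r , i)
  ≡ localNbhdSum r (preceding nothing (columns f) (toℕ i)) (columns f i) (columns f ‼ suc (toℕ i))
nbhdSum-ladder {n} f r i = begin
  nbhdSum (LG n) f (r , i)
    ≡⟨ sumℤ-ladder-rows {n} r _ ⟩
  sum (λ j → if inClosedNbhd (LG n) (r , i) (r , j) then val (f (r , j)) else + 0)
    ℤ.+ sum (λ j → if inClosedNbhd (LG n) (r , i) (opposite r , j) then val (f (opposite r , j)) else + 0)
    ≡⟨ cong₂ ℤ._+_ (sum-cong-≗ (λ j → cong₂ (λ b x → if b then val x else + 0)
                                       (closedNbhd-row r i j) (sym (row-columns f r j))))
                   (sum-cong-≗ (λ j → cong₂ (λ b x → if b then val x else + 0)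
                                       (closedNbhd-rung r i j) (sym (row-columns f (opposite r) j)))) ⟩
  sum (λ j → if near (toℕ i) (toℕ j) then val (row r (F j)) else + 0)
    ℤ.+ sum (λ j → if eqℕ (toℕ i) (toℕ j) then val (row (opposite r) (F j)) else + 0)
    ≡⟨ cong₂ ℤ._+_ (∑-near (val ∘ row r) F (toℕ i)) (∑-point (val ∘ row (opposite r)) F (toℕ i)) ⟩
  valueAt r (F ‼ toℕ i) ℤ.+ valueAt r (F ‼ suc (toℕ i)) ℤ.+ valueAt r (preceding nothing F (toℕ i))
    ℤ.+ valueAt (opposite r) (F ‼ toℕ i)
    ≡⟨ cong (λ x → valueAt r x ℤ.+ valueAt r (F ‼ suc (toℕ i)) ℤ.+ valueAt r (preceding nothing F (toℕ i))
                   ℤ.+ valueAt (opposite r) x) (‼-toℕ F i) ⟩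
  localNbhdSum r (preceding nothing F (toℕ i)) (F i) (F ‼ suc (toℕ i)) ∎
  where F = columns f

module _ {n : ℕ} (f : Fin 2 × Fin n → Label) where

  private
    F = columns f

  covered⇒adjacent-two : ∀ r i → Covered r (preceding nothing F (toℕ i)) (F i) (F ‼ suc (toℕ i)) →
                         Σ (Fin 2 × Fin n) λ v → LadderAdjacent (r , i) v × f v ≡ two
  covered⇒adjacent-two r i (inj₁ t) =
    (opposite r , i) , rung , trans (sym (row-columns f (opposite r) i)) t
  covered⇒adjacent-two r i (inj₂ (inj₁ a)) with preceding-Any F (toℕ i) a
  ... | j , e , t = (r , j) , along (inj₂ e) , trans (sym (row-columns f r j)) t
  covered⇒adjacent-two r i (inj₂ (inj₂ c)) with ‼-Any F (suc (toℕ i)) c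
  ... | j , e , t = (r , j) , along (inj₁ e) , trans (sym (row-columns f r j)) t

  adjacent-two⇒covered : ∀ {r i v} → LadderAdjacent (r , i) v → f v ≡ two →
                         Covered r (preceding nothing F (toℕ i)) (F i) (F ‼ suc (toℕ i))
  adjacent-two⇒covered {r} {i} rung t = inj₁ (trans (row-columns f (opposite r) i) t)
  adjacent-two⇒covered {r} (along {j = j} (inj₁ e)) t =
    inj₂ (inj₂ (Any-‼ F e (trans (row-columns f r j) t)))
  adjacent-two⇒covered {r} (along {j = j} (inj₂ e)) t =
    inj₂ (inj₁ (Any-preceding F e (trans (row-columns f r j) t)))

  srdf⇒locallyAdmissible : IsSRDF (LG n) f → LocallyAdmissible nothing F
  srdf⇒locallyAdmissible S i r =
    subst (+ 1 ℤ.≤_) (nbhdSum-ladder f r i) (IsSRDF.closedSum S (r , i)) ,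
    λ e → cover (IsSRDF.minusCovered S (r , i) (trans (sym (row-columns f r i)) e))
    where
    cover : Σ (Fin 2 × Fin n) (λ v → (ladderAdj (r , i) v ≡ true) × (f v ≡ two)) → Covered r _ (F i) _
    cover (v , a , t) = adjacent-two⇒covered (ladderAdj-complete a) t

  locallyAdmissible⇒srdf : LocallyAdmissible nothing F → IsSRDF (LG n) f
  locallyAdmissible⇒srdf A = record
    { closedSum    = λ { (r , i) → subst (+ 1 ℤ.≤_) (sym (nbhdSum-ladder f r i)) (proj₁ (A i r)) }
    ; minusCovered = λ { (r , i) e →
        witness (covered⇒adjacent-two r i (proj₂ (A i r) (trans (row-columns f r i) e))) }
    }
    where
    witness : ∀ {u} → Σ (Fin 2 × Fin n) (λ v → LadderAdjacent u v × f v ≡ two) →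
              Σ (Fin 2 × Fin n) (λ v → (ladderAdj u v ≡ true) × (f v ≡ two))
    witness (v , a , t) = v , ladderAdj-sound a , t

columnSum : Column → ℤ
columnSum (x , y) = val x ℤ.+ val y

cost : Column → ℤ
cost c = columnSum c ℤ.+ columnSum c ℤ.- + 1

totalCost : ∀ {n} → Vector Column n → ℤ
totalCost F = sum (cost ∘ F)

totalCost-columns : ∀ {n} (f : Fin 2 × Fin n → Label) →
  totalCost (columns f) ≡ weight (LG n) f ℤ.+ weight (LG n) f ℤ.- + n
totalCost-columns {n} f = begin
  totalCost (columns f)
    ≡⟨ ∑-double-pred (columnSum ∘ columns f) ⟩
  sum (columnSum ∘ columns f) ℤ.+ sum (columnSum ∘ columns f) ℤ.- + n
    ≡⟨ cong (λ w → w ℤ.+ w ℤ.- + n) (trans (∑-distrib-+ (λ j → val (f (0F , j))) (λ j → val (f (1F , j))))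
                                           (sym (sumℤ-ladder (val ∘ f)))) ⟩
  weight (LG n) f ℤ.+ weight (LG n) f ℤ.- + n ∎

_≟ᴸ_ : DecidableEquality Label
minus1 ≟ᴸ minus1 = yes refl
minus1 ≟ᴸ one    = no λ ()
minus1 ≟ᴸ two    = no λ ()
one    ≟ᴸ minus1 = no λ ()
one    ≟ᴸ one    = yes refl
one    ≟ᴸ two    = no λ ()
two    ≟ᴸ minus1 = no λ ()
two    ≟ᴸ one    = no λ ()
two    ≟ᴸ two    = yes refl

admissible? : ∀ a b c → Dec (Admissible a b c)
admissible? a b c = all? λ r →
  (+ 1 ℤ.≤? localNbhdSum r a b c) ×-dec
  (row r b ≟ᴸ minus1 →-dec (row (opposite r) b ≟ᴸ two ⊎-dec twoAt? r a ⊎-dec twoAt? r c))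
  where
  twoAt? : ∀ r m → Dec (TwoAt r m)
  twoAt? r = Any.dec (λ c → row r c ≟ᴸ two)

∀-Label? : {P : Label → Set} → (∀ l → Dec (P l)) → Dec (∀ l → P l)
∀-Label? P? = map′ (λ { (p , q , r) → λ { minus1 → p ; one → q ; two → r } })
                   (λ h → h minus1 , h one , h two)
                   (P? minus1 ×-dec P? one ×-dec P? two)

∀-Column? : {P : Column → Set} → (∀ c → Dec (P c)) → Dec (∀ c → P c)
∀-Column? P? = map′ (λ h (x , y) → h x y) (λ h x y → h (x , y))
                    (∀-Label? λ x → ∀-Label? λ y → P? (x , y))

-- tailBound a b is the least cost of an admissible sequence of columns that starts with b after a,
-- found by value iteration; 100 stands in for the pairs that admit no such sequence.
tailBound : Column → Column → ℤ
tailBound (one , one) (minus1 , minus1) = + 0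
tailBound (one , two) (minus1 , minus1) = -[1+ 0 ]
tailBound (two , one) (minus1 , minus1) = -[1+ 0 ]
tailBound (two , two) (minus1 , minus1) = -[1+ 1 ]
tailBound _ (minus1 , minus1) = + 100
tailBound (minus1 , minus1) (minus1 , one) = + 4
tailBound (one , minus1) (minus1 , one) = + 4
tailBound (two , one) (minus1 , one) = -[1+ 0 ]
tailBound (two , two) (minus1 , one) = -[1+ 0 ]
tailBound _ (minus1 , one) = + 3
tailBound (one , one) (minus1 , two) = + 1
tailBound (one , two) (minus1 , two) = + 1
tailBound (two , one) (minus1 , two) = + 1
tailBound (two , two) (minus1 , two) = + 1
tailBound _ (minus1 , two) = + 4
tailBound (minus1 , minus1) (one , minus1) = + 4
tailBound (minus1 , one) (one , minus1) = + 4
tailBound (one , two) (one , minus1) = -[1+ 0 ]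
tailBound (two , two) (one , minus1) = -[1+ 0 ]
tailBound _ (one , minus1) = + 3
tailBound _ (one , one) = + 3
tailBound _ (one , two) = + 4
tailBound (one , one) (two , minus1) = + 1
tailBound (one , two) (two , minus1) = + 1
tailBound (two , one) (two , minus1) = + 1
tailBound (two , two) (two , minus1) = + 1
tailBound _ (two , minus1) = + 4
tailBound _ (two , one) = + 4
tailBound _ (two , two) = + 5

tailBound-last : ∀ a b → Admissible (just a) b nothing → tailBound a b ℤ.≤ cost b
tailBound-last = toWitness {a? = ∀-Column? λ a → ∀-Column? λ b →
  admissible? (just a) b nothing →-dec tailBound a b ℤ.≤? cost b} _

tailBound-step : ∀ a b c → Admissible (just a) b (just c) → tailBound a b ℤ.≤ cost b ℤ.+ tailBound b c
tailBound-step = toWitness {a? = ∀-Column? λ a → ∀-Column? λ b → ∀-Column? λ c →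
  admissible? (just a) b (just c) →-dec tailBound a b ℤ.≤? cost b ℤ.+ tailBound b c} _

tailBound-first : ∀ b c → Admissible nothing b (just c) → + 3 ℤ.≤ cost b ℤ.+ tailBound b c
tailBound-first = toWitness {a? = ∀-Column? λ b → ∀-Column? λ c →
  admissible? nothing b (just c) →-dec + 3 ℤ.≤? cost b ℤ.+ tailBound b c} _

tailBound≤totalCost : ∀ {n} a (F : Vector Column (suc n)) →
                      LocallyAdmissible (just a) F → tailBound a (head F) ℤ.≤ totalCost F
tailBound≤totalCost {zero} a F adm =
  ℤ.≤-trans (tailBound-last a (head F) (adm 0F)) (ℤ.≤-reflexive (sym (ℤ.+-identityʳ _)))
tailBound≤totalCost {suc n} a F adm =
  ℤ.≤-trans (tailBound-step a (head F) (tail F 0F) (adm 0F))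
            (ℤ.+-monoʳ-≤ (cost (head F))
              (tailBound≤totalCost (head F) (tail F) (locallyAdmissible-tail (just a) F adm)))

three≤totalCost : ∀ {n} (F : Vector Column (suc (suc n))) →
                  LocallyAdmissible nothing F → + 3 ℤ.≤ totalCost F
three≤totalCost F adm =
  ℤ.≤-trans (tailBound-first (head F) (tail F 0F) (adm 0F))
            (ℤ.+-monoʳ-≤ (cost (head F))
              (tailBound≤totalCost (head F) (tail F) (locallyAdmissible-tail nothing F adm)))

-- After its first column the optimal labelling repeats (2,1), (-1,-1), (1,2), (-1,-1): each (-1,-1)
-- column sees a 2 in its top row on one side and in its bottom row on the other.
data Phase : Set where
  φ₀ φ₁ φ₂ φ₃ : Phase

step : Phase → Phase
step φ₀ = φ₁
step φ₁ = φ₂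
step φ₂ = φ₃
step φ₃ = φ₀

column closing : Phase → Column
column φ₀ = two , one
column φ₁ = minus1 , minus1
column φ₂ = one , two
column φ₃ = minus1 , minus1
closing φ₀ = two , one
closing φ₁ = minus1 , one
closing φ₂ = one , two
closing φ₃ = one , minus1

costBound : Phase → ℤ
costBound φ₀ = + 5
costBound φ₁ = + 0
costBound φ₂ = + 5
costBound φ₃ = + 0

phaseColumns : ∀ m → Phase → Vector Column (suc m)
phaseColumns zero    s = λ _ → closing s
phaseColumns (suc m) s = column s ∷ᵥ phaseColumns m (step s)

Fits : Phase → Column → Set
Fits s p = Admissible (just p) (closing s) nothing
         × Admissible (just p) (column s) (just (closing (step s)))
         × Admissible (just p) (column s) (just (column (step s)))

fits? : ∀ s p → Dec (Fits s p)
fits? s p = admissible? (just p) (closing s) nothing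
     ×-dec admissible? (just p) (column s) (just (closing (step s)))
     ×-dec admissible? (just p) (column s) (just (column (step s)))

fits-step : ∀ s → Fits (step s) (column s)
fits-step φ₀ = toWitness {a? = fits? φ₁ (column φ₀)} _
fits-step φ₁ = toWitness {a? = fits? φ₂ (column φ₁)} _
fits-step φ₂ = toWitness {a? = fits? φ₃ (column φ₂)} _
fits-step φ₃ = toWitness {a? = fits? φ₀ (column φ₃)} _

phaseColumns-admissible : ∀ m s p → Fits s p → LocallyAdmissible (just p) (phaseColumns m s)
phaseColumns-admissible zero s p (last , _ , _) =
  locallyAdmissible-cons (just p) (phaseColumns zero s) last λ ()
phaseColumns-admissible (suc zero) s p (_ , beforeLast , _) =
  locallyAdmissible-cons (just p) (phaseColumns 1 s) beforeLast
    (phaseColumns-admissible zero (step s) (column s) (fits-step s))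
phaseColumns-admissible (suc (suc m)) s p (_ , _ , inner) =
  locallyAdmissible-cons (just p) (phaseColumns (suc (suc m)) s) inner
    (phaseColumns-admissible (suc m) (step s) (column s) (fits-step s))

closing-cost : ∀ s → cost (closing s) ℤ.≤ costBound s
closing-cost φ₀ = ℤ.≤-refl
closing-cost φ₁ = ℤ.-≤+
closing-cost φ₂ = ℤ.≤-refl
closing-cost φ₃ = ℤ.-≤+

column-cost : ∀ s → cost (column s) ℤ.+ costBound (step s) ≡ costBound s
column-cost φ₀ = refl
column-cost φ₁ = refl
column-cost φ₂ = refl
column-cost φ₃ = refl

phaseColumns-cost : ∀ m s → totalCost (phaseColumns m s) ℤ.≤ costBound s
phaseColumns-cost zero    s = ℤ.≤-trans (ℤ.≤-reflexive (ℤ.+-identityʳ _)) (closing-cost s)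
phaseColumns-cost (suc m) s = ℤ.≤-trans (ℤ.+-monoʳ-≤ (cost (column s)) (phaseColumns-cost m (step s)))
                                        (ℤ.≤-reflexive (column-cost s))

optimalColumns : ∀ m → Vector Column (suc (suc m))
optimalColumns m = (minus1 , one) ∷ᵥ phaseColumns m φ₀

optimalColumns-admissible : ∀ m → LocallyAdmissible nothing (optimalColumns m)
optimalColumns-admissible m = locallyAdmissible-cons nothing (optimalColumns m) (start m)
  (phaseColumns-admissible m φ₀ (minus1 , one) (toWitness {a? = fits? φ₀ (minus1 , one)} _))
  where
  start : ∀ m → Admissible nothing (minus1 , one) (phaseColumns m φ₀ ‼ 0)
  start zero    = toWitness {a? = admissible? nothing (minus1 , one) (just (two , one))} _
  start (suc m) = toWitness {a? = admissible? nothing (minus1 , one) (just (two , one))} _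

optimalColumns-cost : ∀ m → totalCost (optimalColumns m) ℤ.≤ + 4
optimalColumns-cost m = ℤ.+-monoʳ-≤ (cost (minus1 , one)) (phaseColumns-cost m φ₀)

half-bounds : ∀ n → (n + 2) / 2 + (n + 2) / 2 ≤ 2 + n × 2 + n ≤ suc ((n + 2) / 2 + (n + 2) / 2)
half-bounds n = ℕ.≤-trans (ℕ.m≤n+m (q + q) r) (ℕ.≤-reflexive (sym 2+n≡r+2q)) ,
                ℕ.≤-trans (ℕ.≤-reflexive 2+n≡r+2q) (ℕ.+-monoˡ-≤ (q + q) (ℕ.≤-pred (m%n<n (n + 2) 2)))
  where
  q = (n + 2) / 2
  r = (n + 2) % 2
  2+n≡r+2q : 2 + n ≡ r + (q + q)
  2+n≡r+2q = begin
    2 + n         ≡⟨ ℕ.+-comm 2 n ⟩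
    n + 2         ≡⟨ m≡m%n+[m/n]*n (n + 2) 2 ⟩
    r + q ℕ.* 2   ≡⟨ cong (λ m → r + m) (ℕ.*-comm q 2) ⟩
    r + (q + (q + 0)) ≡⟨ cong (λ m → r + (q + m)) (ℕ.+-identityʳ q) ⟩
    r + (q + q)   ∎

halve-lower : ∀ k W → + suc (k + k) ℤ.≤ W ℤ.+ W → + suc k ℤ.≤ W
halve-lower k W h with W ℤ.≤? + k
... | yes W≤k = contradiction (ℤ.≤-trans h (ℤ.+-mono-≤ W≤k W≤k)) λ { (ℤ.+≤+ p) → ℕ.<-irrefl refl p }
... | no  W≰k = ℤ.i<j⇒suc[i]≤j (ℤ.≰⇒> W≰k)

halve-upper : ∀ k W → W ℤ.+ W ℤ.≤ + suc (suc (suc (k + k))) → W ℤ.≤ + suc k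
halve-upper k W h with W ℤ.≤? + suc k
... | yes W≤k = W≤k
... | no  W≰k = contradiction (ℤ.≤-trans (ℤ.+-mono-≤ k<W k<W) h)
                              λ { (ℤ.+≤+ p) → too-big (ℕ.≤-pred (ℕ.≤-pred p)) }
  where
  k<W : + suc (suc k) ℤ.≤ W
  k<W = ℤ.i<j⇒suc[i]≤j (ℤ.≰⇒> W≰k)
  too-big : ¬ k + suc (suc k) ≤ suc (k + k)
  too-big p = ℕ.<-irrefl refl
    (subst (ℕ._≤ suc (k + k)) (trans (ℕ.+-suc k (suc k)) (cong suc (ℕ.+-suc k k))) p)

sub-add : ∀ x y → x ℤ.- y ℤ.+ y ≡ x
sub-add = solve-∀

module _ (m : ℕ) where

  private
    n = suc (suc m)
    q = (n + 2) / 2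

  weight-lower : ∀ f → IsSRDF (LG n) f → + (q + 1) ℤ.≤ weight (LG n) f
  weight-lower f S = subst (ℤ._≤ W) (cong +_ (ℕ.+-comm 1 q))
    (halve-lower q W (ℤ.≤-trans (ℤ.+≤+ (ℕ.s≤s (proj₁ (half-bounds n)))) twice))
    where
    W = weight (LG n) f
    cost≥3 : + 3 ℤ.≤ W ℤ.+ W ℤ.- + n
    cost≥3 = subst (+ 3 ℤ.≤_) (totalCost-columns f)
                   (three≤totalCost (columns f) (srdf⇒locallyAdmissible f S))
    twice : + (3 + n) ℤ.≤ W ℤ.+ W
    twice = subst (+ (3 + n) ℤ.≤_) (sub-add (W ℤ.+ W) (+ n)) (ℤ.+-monoˡ-≤ (+ n) cost≥3)

  weight-upper : weight (LG n) (labelling (optimalColumns m)) ℤ.≤ + (q + 1)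
  weight-upper = subst (W ℤ.≤_) (cong +_ (ℕ.+-comm 1 q))
    (halve-upper q W (ℤ.≤-trans twice (ℤ.+≤+ (ℕ.s≤s (ℕ.s≤s (proj₂ (half-bounds n)))))))
    where
    W = weight (LG n) (labelling (optimalColumns m))
    cost≤4 : W ℤ.+ W ℤ.- + n ℤ.≤ + 4
    cost≤4 = subst (ℤ._≤ + 4) (totalCost-columns (labelling (optimalColumns m))) (optimalColumns-cost m)
    twice : W ℤ.+ W ℤ.≤ + (4 + n)
    twice = subst (ℤ._≤ + (4 + n)) (sub-add (W ℤ.+ W) (+ n)) (ℤ.+-monoˡ-≤ (+ n) cost≤4)

theorem1 : (n : ℕ) → 2 ≤ n → γSR≡ (LG n) (+ ((n + 2) / 2 + 1))
theorem1 (suc (suc m)) (ℕ.s≤s (ℕ.s≤s _)) =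
  (f , srdf , ℤ.≤-antisym (weight-upper m) (weight-lower m f srdf)) , weight-lower m
  where
  f = labelling (optimalColumns m)
  srdf : IsSRDF (LG (suc (suc m))) f
  srdf = locallyAdmissible⇒srdf f (optimalColumns-admissible m)
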